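{- Let $k\geq 1$, let $X$ be a pure $k$-dimensional simplicial complex and let $\mathcal{C}$ be the collection of connected components of $X$. Then $\chi_k(X)\leq \max_{C\in\mathcal{C}}\chi(C_1)$, where $C_1$ is the $1$-skeleton of $C$ (the graph whose vertices are the vertices of $C$ and whose edges are the $2$-element faces of $C$) and $\chi$ denotes the usual graph chromatic number.
   Context: A simplicial complex is a family of subsets of a finite set (faces) closed under subsets; $X_i$ is the set of faces with $i+1$ elements; $X$ is pure of dimension $k$ if every inclusion-maximal face has $k+1$ elements. A $k$-dimensional subcomplex $C$ of $X$ is a connected component of $X$ if, for every $F\in C_{k-1}$, every $k$-face of $X$ containing $F$ belongs to $C$ (equivalently, the connected components correspond to the connected components of the graph on $X_k$ in which two $k$-faces are adjacent when they share a $(k-1)$-face, each component $C$ consisting of such a class of $k$-faces and all their subsets). $K^k_\ell$ is the complete $k$-complex on $\{1,\dots,\ell\}$ (all subsets with at most $k+1$ elements). Orientations: an orientation assigns to each face a linear ordering of its vertices, up to even permutations. If $H$ is oriented as $(x_0,\dots,x_i)$ and $F=H\setminus\{x_j\}$, then $[H:F]=(-1)^j$ if the orientation of $F$ agrees (up to an even permutation) with $(x_0,\dots,\widehat{x_j},\dots,x_i)$ and $-(-1)^j$ otherwise. A homomorphism from a pure $k$-dimensional complex $X$ to a pure $k$-dimensional complex $X'$ is a map $f:X_{k-1}\to X'_{k-1}$ such that there exist orientations of $X$ and $X'$ for which, for every $H\in X_k$, there is $H'\in X'_k$ with (1) $\{f(F): F\in X_{k-1}, F\subset H\}=\{F'\in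 X'_{k-1}: F'\subset H'\}$ and (2) $[H':f(F)]=[H:F]$ for all $F\in X_{k-1}$, $F\subset H$. $\chi_k(X)$ is the smallest $\ell$ such that there is a homomorphism from $X$ to $K^k_\ell$. -}

module Defs where

open import Data.Nat using (ℕ; zero; suc; _≤_; _≤ᵇ_)
open import Data.Bool using (Bool; true; false; T)
open import Data.Vec using ([]; _∷_)
open import Data.Fin using (Fin)
open import Data.Fin.Subset using (Subset; _∈_; _⊆_; ∣_∣)
open import Data.Sign using (Sign; +; -; _*_; opposite)
open import Data.Product using (Σ; ∃; ∃-syntax; _×_; _,_)
open import Relation.Binary.PropositionalEquality using (_≡_; _≢_)
open import Function.Bundles using (_⇔_)

record Complex (n : ℕ) : Set where
  field
    isFace : Subset n → Bool
    down   : ∀ (F G : Subset n) → G ⊆ F → T (isFace F) → T (isFace G)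
open Complex public

-- F ∈ X_{i} with i+1 = m : F is a face of X with exactly m elements.
FaceOfSize : ∀ {n} → Complex n → ℕ → Subset n → Set
FaceOfSize X m F = T (isFace X F) × ∣ F ∣ ≡ m

Pure : ∀ {n} → ℕ → Complex n → Set
Pure k X = ∀ (F : Subset _) → T (isFace X F) →
           (∀ (G : Subset _) → T (isFace X G) → F ⊆ G → G ≡ F) →
           ∣ F ∣ ≡ suc k

completeDown : ∀ {ℓ} (k : ℕ) (F G : Subset ℓ) → G ⊆ F →
               T (∣ F ∣ ≤ᵇ suc k) → T (∣ G ∣ ≤ᵇ suc k)
completeDown k F G G⊆F p =
  Data.Nat.Properties.≤⇒≤ᵇ
    (Data.Nat.Properties.≤-trans (Data.Fin.Subset.Properties.p⊆q⇒∣p∣≤∣q∣ G⊆F)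
                                 (Data.Nat.Properties.≤ᵇ⇒≤ _ _ p))
  where import Data.Nat.Properties
        import Data.Fin.Subset.Properties

K : (k ℓ : ℕ) → Complex ℓ
K k ℓ = record { isFace = λ F → ∣ F ∣ ≤ᵇ suc k ; down = completeDown k }

-- The ordering classes (up to even permutations) of a face F are encoded
-- by a sign relative to the increasing order of the vertices of F (as
-- elements of Fin n): + means "the increasing order", - means "an odd
-- permutation of it".  Faces with at most one vertex have only one
-- ordering class, so their sign is forced to be +.

Orientation : ℕ → Set
Orientation n = Σ (Subset n → Sign) λ σ → ∀ (F : Subset n) → ∣ F ∣ ≤ 1 → σ F ≡ +

-- For F = H ∖ {x}, removedPos H F = number of vertices of H smaller than x,
-- i.e. the index j with x = x_j when H is listed in increasing order.
removedPos : ∀ {n} → Subset n → Subset n → ℕ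
removedPos []          []          = 0
removedPos (true ∷ H)  (false ∷ F) = 0
removedPos (true ∷ H)  (true ∷ F)  = suc (removedPos H F)
removedPos (false ∷ H) (_ ∷ F)     = removedPos H F

signPow : ℕ → Sign
signPow zero    = +
signPow (suc j) = opposite (signPow j)

-- [H : F] for the orientation σ, F = H ∖ {x_j}: (-1)^j if the orientation
-- of F agrees with the induced ordering and -(-1)^j otherwise.
incidence : ∀ {n} → Orientation n → Subset n → Subset n → Sign
incidence (σ , _) H F = σ H * (σ F * signPow (removedPos H F))

-- Homomorphisms of pure k-dimensional complexes: maps X_{k-1} → X'_{k-1}
-- (here k ≥ 1, so X_{k-1} = faces with k elements, X_k = faces with k+1).

Hom : ∀ {n n'} → ℕ → Complex n → Complex n' → Set
Hom {n} {n'} k X X' =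
  Σ (Subset n → Subset n') λ f →
    (∀ (F : Subset n) → FaceOfSize X k F → FaceOfSize X' k (f F)) ×
    ∃[ o ] ∃[ o' ]
      (∀ (H : Subset n) → FaceOfSize X (suc k) H →
         ∃[ H' ] (FaceOfSize X' (suc k) H' ×
           (∀ (F' : Subset n') →
              (∃[ F ] (FaceOfSize X k F × F ⊆ H × f F ≡ F'))
              ⇔ (FaceOfSize X' k F' × F' ⊆ H')) ×
           (∀ (F : Subset n) → FaceOfSize X k F → F ⊆ H →
              incidence {n'} o' H' (f F) ≡ incidence {n} o H F)))

-- χ_k(X) ≤ m : the least ℓ admitting a homomorphism X → K^k_ℓ is ≤ m,
-- i.e. some ℓ ≤ m admits such a homomorphism.
ChiKAtMost : ∀ {n} → ℕ → Complex n → ℕ → Set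
ChiKAtMost k X m = ∃[ ℓ ] (ℓ ≤ m × Hom k X (K k ℓ))

-- Connected components: classes of k-faces under the relation
-- "share a (k-1)-face", together with all their subsets.

-- H and H' share a (k-1)-face (a k-element subset; it is a face of X
-- automatically since X is closed under subsets).
Adjacent : ∀ {n} → ℕ → Subset n → Subset n → Set
Adjacent k H H' = ∃[ F ] (∣ F ∣ ≡ k × F ⊆ H × F ⊆ H')

data Reach {n} (X : Complex n) (k : ℕ) (H₀ : Subset n) : Subset n → Set where
  here : Reach X k H₀ H₀
  step : ∀ {H H'} → Reach X k H₀ H → FaceOfSize X (suc k) H' →
         Adjacent k H H' → Reach X k H₀ H'

CompVertex : ∀ {n} → Complex n → ℕ → Subset n → Fin n → Set
CompVertex X k H₀ v = ∃[ H ] (FaceOfSize X (suc k) H × Reach X k H₀ H × v ∈ H)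

-- Edges of the 1-skeleton of C(H₀): 2-element faces {u,v} of C(H₀),
-- i.e. contained in some k-face of the class of H₀.
CompEdge : ∀ {n} → Complex n → ℕ → Subset n → Fin n → Fin n → Set
CompEdge X k H₀ u v =
  u ≢ v × ∃[ H ] (FaceOfSize X (suc k) H × Reach X k H₀ H × u ∈ H × v ∈ H)

Colourable : ∀ {n} → Complex n → ℕ → Subset n → ℕ → Set
Colourable {n} X k H₀ c =
  Σ ((v : Fin n) → CompVertex X k H₀ v → Fin c) λ col →
    ∀ (u v : Fin n) (pu : CompVertex X k H₀ u) (pv : CompVertex X k H₀ v) →
      CompEdge X k H₀ u v → col u pu ≢ col v pv

ChromaticAtMost : ∀ {n} → Complex n → ℕ → Subset n → ℕ → Set
ChromaticAtMost X k H₀ m = ∃[ c ] (c ≤ m × Colourable X k H₀ c)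

-- Each component C of X has a proper colouring of its 1-skeleton with at most m colours, so the
-- vertices of every k-face of C receive pairwise distinct colours. Send a (k-1)-face to its set
-- of colours; this maps the k-faces and (k-1)-faces of X to those of K^k_m. Orient K^k_m by the
-- increasing order and each face of X by the order of the colours of its vertices. Deleting a
-- vertex x from a k-face H, the parity of the position of the colour of x among the colours of H
-- differs from that of the position of x in H by the number of inversions of the colouring
-- involving x, which is also the parity by which the orientations of H and H - x differ; so the
-- incidence numbers agree. For the map to be well defined, all k-faces of a component must use
-- the same colouring, fixed by a canonical choice of a k-face of the component.

module Submission where

open import Defs
open import Algebra.Properties.CommutativeSemigroup as CommSemigroupProps using ()
open import Data.Bool using (Bool; true; false; T; not; _∧_; _∨_; if_then_else_)
import Data.Bool.Properties as Boolₚ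
open import Data.Empty using (⊥-elim)
open import Data.Fin using (Fin; zero; suc; toℕ; fromℕ<)
import Data.Fin.Properties as Finₚ
open import Data.Fin.Subset
  using (Subset; inside; outside; _∈_; _∉_; _⊆_; _⊂_; ∣_∣; _-_; Nonempty; Empty)
open import Data.Fin.Subset.Properties
  using (_∈?_; _⊆?_; _⊂?_; anySubset?; ⊆-refl; ⊆-trans; ⊆-antisym; p⊂q⇒∣p∣<∣q∣; ∣p∣≤n;
         p─⊥≡p; p─q⊆p; x∈p∧x≢y⇒x∈p-y; Empty-unique; ∣⊥∣≡0)
open import Data.Nat using (ℕ; zero; suc; _+_; _≤_; _<_; _<ᵇ_; _≡ᵇ_; z≤n; s≤s)
open import Data.Nat.Properties
  using (_≟_; ≤-refl; ≤-trans; ≤-reflexive; <-irrefl; <⇒≱; suc-injective; m≤m+n; n≤1+n; +-suc;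
         +-monoʳ-≤; +-mono-≤; +-mono-<-≤; +-mono-≤-<; ≤⇒≤ᵇ)
open import Data.Product using (∃; ∃-syntax; _×_; _,_; proj₁; proj₂)
open import Data.Sign as Sign using (Sign; _*_; opposite)
open import Data.Sign.Properties using (*-commutativeSemigroup; *-identityʳ; *-assoc; s*s≡+)
open import Data.Sum using (_⊎_; inj₁; inj₂)
open import Data.Unit using (⊤; tt)
open import Data.Vec.Base using ([]; _∷_; tabulate)
open import Data.Vec.Properties using (≡-dec; lookup∘tabulate; []=⇒lookup; lookup⇒[]=)
open import Function using (_∘_)
open import Function.Bundles using (_⇔_; mk⇔)
open import Level using (Level)
open import Relation.Nullary using (¬_; Dec; does; yes; no; ¬?; _×-dec_; _⊎-dec_; contradiction)
open import Relation.Nullary.Decidable using (T?; map′; dec-true; does-≡; decidable-stable)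
open import Relation.Unary using (Pred; Decidable)
open import Relation.Binary.PropositionalEquality
  using (_≡_; _≢_; refl; sym; trans; cong; cong₂; subst; module ≡-Reasoning)
import Data.Vec.Base as Vec
open Vec._[_]=_
open CommSemigroupProps *-commutativeSemigroup using (interchange; x∙yz≈y∙xz)

private variable
  ℓ ℓ′ : Level
  n m : ℕ

⊆⇒≡⊎⊂ : {p q : Subset n} → p ⊆ q → p ≡ q ⊎ p ⊂ q
⊆⇒≡⊎⊂ {p = p} {q} p⊆q with Finₚ.any? (λ x → x ∈? q ×-dec ¬? (x ∈? p))
... | yes (x , x∈q , x∉p) = inj₂ (p⊆q , x , x∈q , x∉p)
... | no ∄x =
  inj₁ (⊆-antisym p⊆q λ {x} x∈q → decidable-stable (x ∈? p) λ x∉p → ∄x (x , x∈q , x∉p))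

⊆∧∣q∣≤∣p∣⇒≡ : {p q : Subset n} → p ⊆ q → ∣ q ∣ ≤ ∣ p ∣ → p ≡ q
⊆∧∣q∣≤∣p∣⇒≡ p⊆q ∣q∣≤∣p∣ with ⊆⇒≡⊎⊂ p⊆q
... | inj₁ p≡q = p≡q
... | inj₂ p⊂q = contradiction ∣q∣≤∣p∣ (<⇒≱ (p⊂q⇒∣p∣<∣q∣ p⊂q))

⊆∧∣p∣<∣q∣⇒⊂ : {p q : Subset n} → p ⊆ q → ∣ p ∣ < ∣ q ∣ → p ⊂ q
⊆∧∣p∣<∣q∣⇒⊂ p⊆q ∣p∣<∣q∣ with ⊆⇒≡⊎⊂ p⊆q
... | inj₁ refl = contradiction ∣p∣<∣q∣ (<-irrefl refl)
... | inj₂ p⊂q = p⊂q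

x∈p⇒suc∣p-x∣≡∣p∣ : {p : Subset n} {x : Fin n} → x ∈ p → suc ∣ p - x ∣ ≡ ∣ p ∣
x∈p⇒suc∣p-x∣≡∣p∣ {p = inside ∷ p} here = cong (λ q → suc ∣ q ∣) (p─⊥≡p p)
x∈p⇒suc∣p-x∣≡∣p∣ {p = inside ∷ p} (there x∈p) = cong suc (x∈p⇒suc∣p-x∣≡∣p∣ x∈p)
x∈p⇒suc∣p-x∣≡∣p∣ {p = outside ∷ p} (there x∈p) = x∈p⇒suc∣p-x∣≡∣p∣ x∈p

x∉p-x : {p : Subset n} (x : Fin n) → x ∉ p - x
x∉p-x {p = _ ∷ p} zero ()
x∉p-x {p = _ ∷ p} (suc x) (there x∈) = x∉p-x x x∈

x∈p-y⇒x≢y : {p : Subset n} {x y : Fin n} → x ∈ p - y → x ≢ y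
x∈p-y⇒x≢y {p = p} {x} x∈p-y refl = x∉p-x {p = p} x x∈p-y

∣p∣≡0⇒Empty : {p : Subset n} → ∣ p ∣ ≡ 0 → Empty p
∣p∣≡0⇒Empty {p = outside ∷ p} ∣p∣≡0 (suc x , there x∈p) = ∣p∣≡0⇒Empty ∣p∣≡0 (x , x∈p)

x∈p⇒∣p-x∣≡pred : {p : Subset n} {x : Fin n} {t : ℕ} → x ∈ p → ∣ p ∣ ≡ suc t → ∣ p - x ∣ ≡ t
x∈p⇒∣p-x∣≡pred x∈p ∣p∣≡ = suc-injective (trans (x∈p⇒suc∣p-x∣≡∣p∣ x∈p) ∣p∣≡)

Empty⇒∣p∣≡0 : {p : Subset n} → Empty p → ∣ p ∣ ≡ 0
Empty⇒∣p∣≡0 {n} empty = trans (cong ∣_∣ (Empty-unique empty)) (∣⊥∣≡0 n)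

∣p∣≡suc⇒Nonempty : {p : Subset n} {t : ℕ} → ∣ p ∣ ≡ suc t → Nonempty p
∣p∣≡suc⇒Nonempty {p = inside ∷ p} _ = zero , here
∣p∣≡suc⇒Nonempty {p = outside ∷ p} ∣p∣≡suc with ∣p∣≡suc⇒Nonempty ∣p∣≡suc
... | x , x∈p = suc x , there x∈p

⊆∧suc∣p∣≡∣q∣⇒≡q-x : {p q : Subset n} → p ⊆ q → suc ∣ p ∣ ≡ ∣ q ∣ →
                     ∃ λ x → x ∈ q × p ≡ q - x
⊆∧suc∣p∣≡∣q∣⇒≡q-x {p = p} {q} p⊆q ∣q∣≡ with ⊆∧∣p∣<∣q∣⇒⊂ p⊆q (≤-reflexive ∣q∣≡)
... | _ , x , x∈q , x∉p = x , x∈q , ⊆∧∣q∣≤∣p∣⇒≡ p⊆q-x (≤-reflexive ∣q-x∣≡∣p∣)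
  where
  p⊆q-x : p ⊆ q - x
  p⊆q-x y∈p = x∈p∧x≢y⇒x∈p-y (p⊆q y∈p) λ { refl → x∉p y∈p }
  ∣q-x∣≡∣p∣ : ∣ q - x ∣ ≡ ∣ p ∣
  ∣q-x∣≡∣p∣ = x∈p⇒∣p-x∣≡pred x∈q (sym ∣q∣≡)

removal-induction : (P : Subset n → Set ℓ) →
                    (∀ {p} → Empty p → P p) →
                    (∀ {p x} → x ∈ p → P (p - x) → P p) →
                    ∀ p → P p
removal-induction P empty remove p = go ∣ p ∣ p refl
  where
  go : ∀ t p → ∣ p ∣ ≡ t → P p
  go zero    p ∣p∣≡0 = empty (∣p∣≡0⇒Empty ∣p∣≡0)
  go (suc t) p ∣p∣≡ with ∣p∣≡suc⇒Nonempty ∣p∣≡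
  ... | x , x∈p = remove x∈p (go t (p - x) (x∈p⇒∣p-x∣≡pred x∈p ∣p∣≡))

count : {P : Pred (Subset n) ℓ} → Decidable P → ℕ
count {zero}  P? = if does (P? []) then 1 else 0
count {suc n} P? = count (P? ∘ (inside ∷_)) + count (P? ∘ (outside ∷_))

count-mono : {P : Pred (Subset n) ℓ} {Q : Pred (Subset n) ℓ′} (P? : Decidable P) (Q? : Decidable Q) →
             (∀ {p} → P p → Q p) → count P? ≤ count Q?
count-mono {zero} P? Q? P⇒Q with P? [] | Q? []
... | yes _  | yes _  = ≤-refl
... | yes P[] | no ¬Q[] = contradiction (P⇒Q P[]) ¬Q[]
... | no _   | _      = z≤n
count-mono {suc n} P? Q? P⇒Q =
  +-mono-≤ (count-mono (P? ∘ (inside ∷_)) (Q? ∘ (inside ∷_)) P⇒Q)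
           (count-mono (P? ∘ (outside ∷_)) (Q? ∘ (outside ∷_)) P⇒Q)

count-strict : {P : Pred (Subset n) ℓ} {Q : Pred (Subset n) ℓ′} (P? : Decidable P) (Q? : Decidable Q) →
               (∀ {p} → P p → Q p) → ∀ {p} → Q p → ¬ P p → count P? < count Q?
count-strict {zero} P? Q? P⇒Q {[]} Qp ¬Pp with P? [] | Q? []
... | yes P[] | _      = contradiction P[] ¬Pp
... | no _    | yes _  = s≤s z≤n
... | no _    | no ¬Q[] = contradiction Qp ¬Q[]
count-strict {suc n} P? Q? P⇒Q {inside ∷ p} Qp ¬Pp =
  +-mono-<-≤ (count-strict (P? ∘ (inside ∷_)) (Q? ∘ (inside ∷_)) P⇒Q Qp ¬Pp)
             (count-mono (P? ∘ (outside ∷_)) (Q? ∘ (outside ∷_)) P⇒Q)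
count-strict {suc n} P? Q? P⇒Q {outside ∷ p} Qp ¬Pp =
  +-mono-≤-< (count-mono (P? ∘ (inside ∷_)) (Q? ∘ (inside ∷_)) P⇒Q)
             (count-strict (P? ∘ (outside ∷_)) (Q? ∘ (outside ∷_)) P⇒Q Qp ¬Pp)

#Subset : ℕ → ℕ
#Subset n = count {P = λ (_ : Subset n) → ⊤} (λ _ → yes tt)

count≤#Subset : {P : Pred (Subset n) ℓ} (P? : Decidable P) → count P? ≤ #Subset n
count≤#Subset P? = count-mono P? (λ _ → yes tt) _

firstSubset : {P : Pred (Subset n) ℓ} → Decidable P → Subset n
firstSubset {zero}  P? = []
firstSubset {suc n} P? with anySubset? (P? ∘ (inside ∷_))
... | yes _ = inside ∷ firstSubset (P? ∘ (inside ∷_))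
... | no _  = outside ∷ firstSubset (P? ∘ (outside ∷_))

firstSubset-satisfies : {P : Pred (Subset n) ℓ} (P? : Decidable P) → ∃ P → P (firstSubset P?)
firstSubset-satisfies {zero}  P? ([] , P[]) = P[]
firstSubset-satisfies {suc n} P? (p , Pp) with anySubset? (P? ∘ (inside ∷_)) | p
... | yes ∃in | _           = firstSubset-satisfies (P? ∘ (inside ∷_)) ∃in
... | no ∄in  | inside ∷ q  = contradiction (q , Pp) ∄in
... | no _    | outside ∷ q = firstSubset-satisfies (P? ∘ (outside ∷_)) (q , Pp)

firstSubset-cong : {P Q : Pred (Subset n) ℓ} (P? : Decidable P) (Q? : Decidable Q) →
                   (∀ {p} → P p → Q p) → (∀ {p} → Q p → P p) → firstSubset P? ≡ firstSubset Q?
firstSubset-cong {zero}  P? Q? _ _ = refl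
firstSubset-cong {suc n} P? Q? P⇒Q Q⇒P
  with anySubset? (P? ∘ (inside ∷_)) | anySubset? (Q? ∘ (inside ∷_))
... | yes _         | yes _         =
  cong (inside ∷_) (firstSubset-cong (P? ∘ (inside ∷_)) (Q? ∘ (inside ∷_)) P⇒Q Q⇒P)
... | no _          | no _          =
  cong (outside ∷_) (firstSubset-cong (P? ∘ (outside ∷_)) (Q? ∘ (outside ∷_)) P⇒Q Q⇒P)
... | yes (p , Pp)  | no ∄Q         = contradiction (p , P⇒Q Pp) ∄Q
... | no ∄P         | yes (p , Qp)  = contradiction (p , Q⇒P Qp) ∄P

module BoundedReachability (_↝_ : Subset n → Subset n → Set) (_↝?_ : ∀ a b → Dec (a ↝ b)) where

  Within : ℕ → Subset n → Subset n → Set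
  Within zero    a b = a ≡ b
  Within (suc i) a b = Within i a b ⊎ ∃ λ c → Within i a c × c ↝ b

  within? : ∀ i a b → Dec (Within i a b)
  within? zero    a b = ≡-dec Boolₚ._≟_ a b
  within? (suc i) a b = within? i a b ⊎-dec anySubset? λ c → within? i a c ×-dec c ↝? b

  within-refl : ∀ i a → Within i a a
  within-refl zero    a = refl
  within-refl (suc i) a = inj₁ (within-refl i a)

  Stable : Subset n → ℕ → Set
  Stable a j = ∀ {b} → Within (suc j) a b → Within j a b

  stable⇒saturated : ∀ {a j} → Stable a j → ∀ i {b} → Within i a b → Within j a b
  stable⇒saturated {a} {j} stable zero    refl                 = within-refl j a
  stable⇒saturated         stable (suc i) (inj₁ w)             = stable⇒saturated stable i w
  stable⇒saturated         stable (suc i) (inj₂ (c , w , c↝b)) =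
    stable (inj₂ (c , stable⇒saturated stable i w , c↝b))

  -- Until it stabilises, the set of subsets reachable within i steps gains an element at each
  -- step; since there are only #Subset n subsets, it must stabilise.
  grows-or-stable : ∀ a i → i ≤ count (within? i a) ⊎ ∃ (Stable a)
  grows-or-stable a zero = inj₁ z≤n
  grows-or-stable a (suc i) with grows-or-stable a i
  ... | inj₂ stable = inj₂ stable
  ... | inj₁ i≤count with anySubset? (λ b → within? (suc i) a b ×-dec ¬? (within? i a b))
  ...   | yes (b , w , ¬w) =
    inj₁ (≤-trans (s≤s i≤count) (count-strict (within? i a) (within? (suc i) a) inj₁ w ¬w))
  ...   | no ∄b = inj₂ (i , λ {b} w → decidable-stable (within? i a b) λ ¬w → ∄b (b , w , ¬w))

  stable : ∀ a → ∃ (Stable a)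
  stable a with grows-or-stable a (suc (#Subset n))
  ... | inj₂ s = s
  ... | inj₁ #<count =
    contradiction (≤-trans #<count (count≤#Subset (within? (suc (#Subset n)) a))) (<-irrefl refl)

  reachable? : ∀ a b → Dec (∃ λ i → Within i a b)
  reachable? a b with stable a
  ... | j , stable-j with within? j a b
  ...   | yes w = yes (j , w)
  ...   | no ¬w = no λ (i , w) → ¬w (stable⇒saturated stable-j i w)

∏ : Subset n → (Fin n → Sign) → Sign
∏ {zero}  _             _ = Sign.+
∏ {suc n} (inside ∷ p)  t = t zero * ∏ p (λ v → t (suc v))
∏ {suc n} (outside ∷ p) t = ∏ p (λ v → t (suc v))

∏-remove : ∀ {p : Subset n} {x} (t : Fin n → Sign) → x ∈ p → ∏ p t ≡ t x * ∏ (p - x) t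
∏-remove {p = inside ∷ p} t here = cong (λ q → t zero * ∏ q (λ v → t (suc v))) (sym (p─⊥≡p p))
∏-remove {p = inside ∷ p} {suc x} t (there x∈p) =
  trans (cong (t zero *_) (∏-remove (λ v → t (suc v)) x∈p)) (x∙yz≈y∙xz (t zero) (t (suc x)) _)
∏-remove {p = outside ∷ p} t (there x∈p) = ∏-remove (λ v → t (suc v)) x∈p

∏-cong : ∀ (p : Subset n) {t u : Fin n → Sign} → (∀ {v} → v ∈ p → t v ≡ u v) → ∏ p t ≡ ∏ p u
∏-cong {zero}  _             _   = refl
∏-cong {suc n} (inside ∷ p)  t≡u = cong₂ _*_ (t≡u here) (∏-cong p λ v∈p → t≡u (there v∈p))
∏-cong {suc n} (outside ∷ p) t≡u = ∏-cong p λ v∈p → t≡u (there v∈p)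

∏-distrib : ∀ (p : Subset n) (t u : Fin n → Sign) → ∏ p (λ v → t v * u v) ≡ ∏ p t * ∏ p u
∏-distrib {zero}  _             _ _ = refl
∏-distrib {suc n} (inside ∷ p)  t u =
  trans (cong (t zero * u zero *_) (∏-distrib p _ _)) (interchange (t zero) (u zero) _ _)
∏-distrib {suc n} (outside ∷ p) t u = ∏-distrib p _ _

∏-Empty : ∀ {p : Subset n} (t : Fin n → Sign) → Empty p → ∏ p t ≡ Sign.+
∏-Empty {zero}                t _ = refl
∏-Empty {suc n} {inside ∷ p}  t empty = contradiction (zero , here) empty
∏-Empty {suc n} {outside ∷ p} t empty = ∏-Empty _ λ (x , x∈p) → empty (suc x , there x∈p)

∏-singleton : ∀ {p : Subset n} {x} (t : Fin n → Sign) → x ∈ p → ∣ p ∣ ≡ 1 → ∏ p t ≡ t x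
∏-singleton {p = p} {x} t x∈p ∣p∣≡1 = begin
  ∏ p t              ≡⟨ ∏-remove t x∈p ⟩
  t x * ∏ (p - x) t  ≡⟨ cong (t x *_) (∏-Empty t (∣p∣≡0⇒Empty (x∈p⇒∣p-x∣≡pred x∈p ∣p∣≡1))) ⟩
  t x * Sign.+       ≡⟨ *-identityʳ (t x) ⟩
  t x                ∎
  where open ≡-Reasoning

sign : Bool → Sign
sign true  = Sign.-
sign false = Sign.+

below : ℕ → ℕ → Sign
below a b = sign (a <ᵇ b)

∏-+ : ∀ (p : Subset n) → ∏ p (λ _ → Sign.+) ≡ Sign.+
∏-+ {zero}  _             = refl
∏-+ {suc n} (inside ∷ p)  = ∏-+ p
∏-+ {suc n} (outside ∷ p) = ∏-+ p

signPow-removedPos : ∀ {p : Subset n} {x} → x ∈ p →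
                     signPow (removedPos p (p - x)) ≡ ∏ p (λ v → below (toℕ v) (toℕ x))
signPow-removedPos {p = inside ∷ p}  here        = sym (∏-+ p)
signPow-removedPos {p = inside ∷ p}  (there x∈p) = cong opposite (signPow-removedPos x∈p)
signPow-removedPos {p = outside ∷ p} (there x∈p) = signPow-removedPos x∈p

<ᵇ-irrefl : ∀ a → (a <ᵇ a) ≡ false
<ᵇ-irrefl zero    = refl
<ᵇ-irrefl (suc a) = <ᵇ-irrefl a

<ᵇ-asym : ∀ a b → (a <ᵇ b) ∧ (b <ᵇ a) ≡ false
<ᵇ-asym zero    zero    = refl
<ᵇ-asym zero    (suc b) = refl
<ᵇ-asym (suc a) zero    = refl
<ᵇ-asym (suc a) (suc b) = <ᵇ-asym a b

<ᵇ-connex : ∀ a b → (a <ᵇ b) ∨ (b <ᵇ a) ≡ not (a ≡ᵇ b)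
<ᵇ-connex zero    zero    = refl
<ᵇ-connex zero    (suc b) = refl
<ᵇ-connex (suc a) zero    = refl
<ᵇ-connex (suc a) (suc b) = <ᵇ-connex a b

≡ᵇ-cong-⇔ : ∀ {a b c d} → (a ≡ b → c ≡ d) → (c ≡ d → a ≡ b) → (a ≡ᵇ b) ≡ (c ≡ᵇ d)
≡ᵇ-cong-⇔ {a} {b} {c} {d} to from = does-≡ (a ≟ b) (map′ from to (c ≟ d))

sign-transfer : ∀ p q r s → p ∧ q ≡ false → r ∧ s ≡ false → p ∨ q ≡ r ∨ s →
                sign r ≡ sign (q ∧ r) * sign (p ∧ s) * sign p
sign-transfer false false false _     _  _  _  = refl
sign-transfer false false true  _     _  _  ()
sign-transfer false true  false _     _  _  _  = refl
sign-transfer false true  true  _     _  _  _  = refl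
sign-transfer true  false false false _  _  ()
sign-transfer true  false false true  _  _  _  = refl
sign-transfer true  false true  false _  _  _  = refl
sign-transfer true  false true  true  _  () _
sign-transfer true  true  _     _     () _  _

module Inversions (κ : Fin n → ℕ) where

  inversion : Fin n → Fin n → Sign
  inversion u v = sign ((toℕ u <ᵇ toℕ v) ∧ (κ v <ᵇ κ u))

  -- The sign of the permutation ordering p by κ, relative to the increasing order of Fin n
  -- (when κ is injective on p).
  sortSign : Subset n → Sign
  sortSign p = ∏ p (λ u → ∏ p (inversion u))

  inversion-refl : ∀ x → inversion x x ≡ Sign.+
  inversion-refl x = cong (λ b → sign (b ∧ (κ x <ᵇ κ x))) (<ᵇ-irrefl (toℕ x))

  below-transfer : ∀ {u x} → (κ u ≡ κ x → u ≡ x) →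
                   below (κ u) (κ x) ≡ inversion x u * inversion u x * below (toℕ u) (toℕ x)
  below-transfer {u} {x} injective =
    sign-transfer (toℕ u <ᵇ toℕ x) (toℕ x <ᵇ toℕ u) (κ u <ᵇ κ x) (κ x <ᵇ κ u)
    (<ᵇ-asym (toℕ u) (toℕ x))
    (<ᵇ-asym (κ u) (κ x))
    (begin
      (toℕ u <ᵇ toℕ x) ∨ (toℕ x <ᵇ toℕ u)  ≡⟨ <ᵇ-connex (toℕ u) (toℕ x) ⟩
      not (toℕ u ≡ᵇ toℕ x)
        ≡⟨ cong not (≡ᵇ-cong-⇔ (cong κ ∘ Finₚ.toℕ-injective) (cong toℕ ∘ injective)) ⟩
      not (κ u ≡ᵇ κ x)                      ≡⟨ sym (<ᵇ-connex (κ u) (κ x)) ⟩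
      (κ u <ᵇ κ x) ∨ (κ x <ᵇ κ u)          ∎)
    where open ≡-Reasoning

  sortSign-remove : ∀ {p : Subset n} {x} → x ∈ p →
                    sortSign p * sortSign (p - x) ≡ ∏ p (inversion x) * ∏ p (λ u → inversion u x)
  sortSign-remove {p} {x} x∈p = begin
    sortSign p * sortSign (p - x)
      ≡⟨ cong (_* sortSign (p - x)) (∏-remove _ x∈p) ⟩
    ∏ p (inversion x) * ∏ (p - x) (λ u → ∏ p (inversion u)) * sortSign (p - x)
      ≡⟨ cong (λ s → ∏ p (inversion x) * s * sortSign (p - x)) (∏-cong (p - x) λ _ → ∏-remove _ x∈p) ⟩
    ∏ p (inversion x) * ∏ (p - x) (λ u → inversion u x * ∏ (p - x) (inversion u)) * sortSign (p - x)
      ≡⟨ cong (λ s → ∏ p (inversion x) * s * sortSign (p - x)) (∏-distrib (p - x) _ _) ⟩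
    ∏ p (inversion x) * (∏ (p - x) (λ u → inversion u x) * sortSign (p - x)) * sortSign (p - x)
      ≡⟨ cancel (∏ p (inversion x)) _ (sortSign (p - x)) ⟩
    ∏ p (inversion x) * ∏ (p - x) (λ u → inversion u x)
      ≡⟨ cong (∏ p (inversion x) *_) (sym column) ⟩
    ∏ p (inversion x) * ∏ p (λ u → inversion u x)  ∎
    where
    open ≡-Reasoning
    cancel : ∀ a b s → a * (b * s) * s ≡ a * b
    cancel a b s = begin
      a * (b * s) * s  ≡⟨ cong (_* s) (sym (*-assoc a b s)) ⟩
      a * b * s * s    ≡⟨ *-assoc (a * b) s s ⟩
      a * b * (s * s)  ≡⟨ cong (a * b *_) (s*s≡+ s) ⟩
      a * b * Sign.+   ≡⟨ *-identityʳ (a * b) ⟩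
      a * b            ∎
    column : ∏ p (λ u → inversion u x) ≡ ∏ (p - x) (λ u → inversion u x)
    column = trans (∏-remove _ x∈p) (cong (_* ∏ (p - x) (λ u → inversion u x)) (inversion-refl x))

  sortSign-≤1 : ∀ (p : Subset n) → ∣ p ∣ ≤ 1 → sortSign p ≡ Sign.+
  sortSign-≤1 p ∣p∣≤1 with ∣ p ∣ in ∣p∣≡
  sortSign-≤1 p z≤n       | zero = ∏-Empty {p = p} _ (∣p∣≡0⇒Empty ∣p∣≡)
  sortSign-≤1 p (s≤s z≤n) | suc zero with ∣p∣≡suc⇒Nonempty ∣p∣≡
  ... | x , x∈p = begin
    sortSign p           ≡⟨ ∏-singleton {p = p} _ x∈p ∣p∣≡ ⟩
    ∏ p (inversion x)    ≡⟨ ∏-singleton {p = p} _ x∈p ∣p∣≡ ⟩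
    inversion x x        ≡⟨ inversion-refl x ⟩
    Sign.+               ∎
    where open ≡-Reasoning

record InjectsInto (κ : Fin n → ℕ) (p : Subset n) (m : ℕ) : Set where
  field
    bounded   : ∀ {v} → v ∈ p → κ v < m
    injective : ∀ {u v} → u ∈ p → v ∈ p → κ u ≡ κ v → u ≡ v

InjectsInto-⊆ : ∀ {κ : Fin n → ℕ} {p q} → q ⊆ p → InjectsInto κ p m → InjectsInto κ q m
InjectsInto-⊆ q⊆p inj = record
  { bounded   = bounded ∘ q⊆p
  ; injective = λ u∈q v∈q → injective (q⊆p u∈q) (q⊆p v∈q)
  }
  where open InjectsInto inj

subsetOf : {P : Pred (Fin m) ℓ} → Decidable P → Subset m
subsetOf P? = tabulate (does ∘ P?)

∈-subsetOf⁺ : ∀ {P : Pred (Fin m) ℓ} (P? : Decidable P) {i} → P i → i ∈ subsetOf P?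
∈-subsetOf⁺ P? {i} Pi = lookup⇒[]= i _ (trans (lookup∘tabulate _ i) (dec-true (P? i) Pi))

∈-subsetOf⁻ : ∀ {P : Pred (Fin m) ℓ} (P? : Decidable P) {i} → i ∈ subsetOf P? → P i
∈-subsetOf⁻ P? {i} i∈ with P? i | trans (sym (lookup∘tabulate (does ∘ P?) i)) ([]=⇒lookup i∈)
... | yes Pi | _ = Pi

module Image (κ : Fin n → ℕ) (m : ℕ) where

  open Inversions κ

  HitFrom : Subset n → Fin m → Set
  HitFrom p i = ∃ λ v → v ∈ p × κ v ≡ toℕ i

  hitFrom? : ∀ p → Decidable (HitFrom p)
  hitFrom? p i = Finₚ.any? λ v → v ∈? p ×-dec κ v ≟ toℕ i

  image : Subset n → Subset m
  image p = subsetOf (hitFrom? p)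

  ∈-image⁺ : ∀ {p v i} → v ∈ p → κ v ≡ toℕ i → i ∈ image p
  ∈-image⁺ {p} v∈p κv≡i = ∈-subsetOf⁺ (hitFrom? p) (_ , v∈p , κv≡i)

  ∈-image⁻ : ∀ {p i} → i ∈ image p → HitFrom p i
  ∈-image⁻ {p} = ∈-subsetOf⁻ (hitFrom? p)

  image-mono : ∀ {p q} → p ⊆ q → image p ⊆ image q
  image-mono p⊆q i∈ with ∈-image⁻ i∈
  ... | v , v∈p , κv≡i = ∈-image⁺ (p⊆q v∈p) κv≡i

  module _ {p : Subset n} (inj : InjectsInto κ p m) where

    open InjectsInto inj

    image-remove : ∀ {x j} → x ∈ p → κ x ≡ toℕ j → image (p - x) ≡ image p - j
    image-remove {x} {j} x∈p κx≡j = ⊆-antisym ⊆-from ⊆-to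
      where
      ⊆-from : image (p - x) ⊆ image p - j
      ⊆-from i∈ with ∈-image⁻ i∈
      ... | v , v∈p-x , κv≡i = x∈p∧x≢y⇒x∈p-y (∈-image⁺ v∈p κv≡i) λ { refl →
        x∈p-y⇒x≢y v∈p-x (injective v∈p x∈p (trans κv≡i (sym κx≡j))) }
        where v∈p = p─q⊆p _ _ v∈p-x
      ⊆-to : image p - j ⊆ image (p - x)
      ⊆-to i∈ with ∈-image⁻ (p─q⊆p _ _ i∈)
      ... | v , v∈p , κv≡i = ∈-image⁺ (x∈p∧x≢y⇒x∈p-y v∈p λ { refl →
        x∈p-y⇒x≢y i∈ (Finₚ.toℕ-injective (trans (sym κv≡i) κx≡j)) }) κv≡i

  image-Empty : ∀ {p} → Empty p → Empty (image p)
  image-Empty empty (i , i∈) with ∈-image⁻ i∈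
  ... | v , v∈p , _ = empty (v , v∈p)

  asFin : ∀ {p x} → InjectsInto κ p m → x ∈ p → ∃ λ j → κ x ≡ toℕ j
  asFin inj x∈p = fromℕ< (InjectsInto.bounded inj x∈p) , sym (Finₚ.toℕ-fromℕ< _)

  ∣image∣ : ∀ p → InjectsInto κ p m → ∣ image p ∣ ≡ ∣ p ∣
  ∣image∣ = removal-induction _
    (λ empty _ → trans (Empty⇒∣p∣≡0 (image-Empty empty)) (sym (Empty⇒∣p∣≡0 empty)))
    λ {p} {x} x∈p ih inj → let j , κx≡j = asFin inj x∈p in begin
      ∣ image p ∣            ≡⟨ sym (x∈p⇒suc∣p-x∣≡∣p∣ (∈-image⁺ x∈p κx≡j)) ⟩
      suc ∣ image p - j ∣    ≡⟨ cong (suc ∘ ∣_∣) (sym (image-remove inj x∈p κx≡j)) ⟩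
      suc ∣ image (p - x) ∣  ≡⟨ cong suc (ih (InjectsInto-⊆ (p─q⊆p _ _) inj)) ⟩
      suc ∣ p - x ∣          ≡⟨ x∈p⇒suc∣p-x∣≡∣p∣ x∈p ⟩
      ∣ p ∣                  ∎
    where open ≡-Reasoning

  ∏-image : ∀ (g : ℕ → Sign) p → InjectsInto κ p m → ∏ (image p) (g ∘ toℕ) ≡ ∏ p (g ∘ κ)
  ∏-image g = removal-induction _
    (λ {p} empty _ → trans (∏-Empty {p = image p} _ (image-Empty empty)) (sym (∏-Empty {p = p} _ empty)))
    λ {p} {x} x∈p ih inj → let j , κx≡j = asFin inj x∈p in begin
      ∏ (image p) (g ∘ toℕ)                  ≡⟨ ∏-remove _ (∈-image⁺ x∈p κx≡j) ⟩
      g (toℕ j) * ∏ (image p - j) (g ∘ toℕ)  ≡⟨ cong₂ _*_ (cong g (sym κx≡j))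
                                                          (cong (λ q → ∏ q (g ∘ toℕ)) (sym (image-remove inj x∈p κx≡j))) ⟩
      g (κ x) * ∏ (image (p - x)) (g ∘ toℕ)  ≡⟨ cong (g (κ x) *_) (ih (InjectsInto-⊆ (p─q⊆p _ _) inj)) ⟩
      g (κ x) * ∏ (p - x) (g ∘ κ)            ≡⟨ sym (∏-remove _ x∈p) ⟩
      ∏ p (g ∘ κ)                            ∎
    where open ≡-Reasoning

  position-image : ∀ {p x} → InjectsInto κ p m → x ∈ p →
                   signPow (removedPos (image p) (image (p - x)))
                     ≡ sortSign p * (sortSign (p - x) * signPow (removedPos p (p - x)))
  position-image {p} {x} inj x∈p = begin
    signPow (removedPos (image p) (image (p - x)))
      ≡⟨ cong (signPow ∘ removedPos (image p)) (image-remove inj x∈p κx≡j) ⟩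
    signPow (removedPos (image p) (image p - j))
      ≡⟨ signPow-removedPos (∈-image⁺ x∈p κx≡j) ⟩
    ∏ (image p) (λ i → below (toℕ i) (toℕ j))
      ≡⟨ ∏-image (λ a → below a (toℕ j)) p inj ⟩
    ∏ p (λ v → below (κ v) (toℕ j))
      ≡⟨ ∏-cong p (λ v∈p → trans (cong (below _) (sym κx≡j)) (below-transfer (injective v∈p x∈p))) ⟩
    ∏ p (λ v → inversion x v * inversion v x * below (toℕ v) (toℕ x))
      ≡⟨ trans (∏-distrib p _ _) (cong (_* _) (∏-distrib p _ _)) ⟩
    ∏ p (inversion x) * ∏ p (λ v → inversion v x) * ∏ p (λ v → below (toℕ v) (toℕ x))
      ≡⟨ cong₂ _*_ (sym (sortSign-remove x∈p)) (sym (signPow-removedPos x∈p)) ⟩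
    sortSign p * sortSign (p - x) * signPow (removedPos p (p - x))
      ≡⟨ *-assoc (sortSign p) _ _ ⟩
    sortSign p * (sortSign (p - x) * signPow (removedPos p (p - x)))  ∎
    where
    open ≡-Reasoning
    open InjectsInto inj
    j : Fin m
    j = proj₁ (asFin inj x∈p)
    κx≡j : κ x ≡ toℕ j
    κx≡j = proj₂ (asFin inj x∈p)

Maximal : Complex n → Subset n → Set
Maximal X F = ∀ G → T (isFace X G) → F ⊆ G → G ≡ F

maximal-extension : (X : Complex n) {F : Subset n} → T (isFace X F) →
                    ∃ λ G → T (isFace X G) × F ⊆ G × Maximal X G
maximal-extension {n} X {F} = extend n F (m≤m+n n ∣ F ∣)
  where
  extend : ∀ t F → n ≤ t + ∣ F ∣ → T (isFace X F) → ∃ λ G → T (isFace X G) × F ⊆ G × Maximal X G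
  extend t F n≤t+∣F∣ F∈X with anySubset? (λ G → T? (isFace X G) ×-dec F ⊂? G)
  extend t F n≤t+∣F∣ F∈X | no ∄G = F , F∈X , ⊆-refl , maximal
    where
    maximal : Maximal X F
    maximal G G∈X F⊆G with ⊆⇒≡⊎⊂ F⊆G
    ... | inj₁ F≡G = sym F≡G
    ... | inj₂ F⊂G = contradiction (G , G∈X , F⊂G) ∄G
  extend zero F n≤∣F∣ F∈X | yes (G , G∈X , F⊂G) =
    contradiction n≤∣F∣ (<⇒≱ (≤-trans (p⊂q⇒∣p∣<∣q∣ F⊂G) (∣p∣≤n G)))
  extend (suc t) F n≤t+∣F∣ F∈X | yes (G , G∈X , F⊂G) with extend t G n≤t+∣G∣ G∈X
    where
    n≤t+∣G∣ : n ≤ t + ∣ G ∣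
    n≤t+∣G∣ = ≤-trans n≤t+∣F∣
      (≤-trans (≤-reflexive (sym (+-suc t ∣ F ∣))) (+-monoʳ-≤ t (p⊂q⇒∣p∣<∣q∣ F⊂G)))
  ... | H , H∈X , G⊆H , maximal = H , H∈X , ⊆-trans (proj₁ F⊂G) G⊆H , maximal

Adjacent-sym : ∀ {k} {H H' : Subset n} → Adjacent k H H' → Adjacent k H' H
Adjacent-sym (F , ∣F∣≡k , F⊆H , F⊆H') = F , ∣F∣≡k , F⊆H' , F⊆H

adjacent? : ∀ k (H H' : Subset n) → Dec (Adjacent k H H')
adjacent? k H H' = anySubset? λ F → ∣ F ∣ ≟ k ×-dec F ⊆? H ×-dec F ⊆? H'

faceOfSize? : ∀ (X : Complex n) j → Decidable (FaceOfSize X j)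
faceOfSize? X j F = T? (isFace X F) ×-dec ∣ F ∣ ≟ j

K-faceOfSize : ∀ {k m j} (S : Subset m) → j ≤ suc k → ∣ S ∣ ≡ j → FaceOfSize (K k m) j S
K-faceOfSize S j≤1+k refl = ≤⇒≤ᵇ j≤1+k , refl

module Components {n} (k : ℕ) (X : Complex n) where

  open BoundedReachability (λ H H' → FaceOfSize X (suc k) H' × Adjacent k H H')
                           (λ H H' → faceOfSize? X (suc k) H' ×-dec adjacent? k H H')

  Within⇒Reach : ∀ {i a b} → Within i a b → Reach X k a b
  Within⇒Reach {zero}  refl                       = here
  Within⇒Reach {suc i} (inj₁ w)                   = Within⇒Reach w
  Within⇒Reach {suc i} (inj₂ (c , w , b∈X , adj)) = step (Within⇒Reach w) b∈X adj

  Reach⇒Within : ∀ {a b} → Reach X k a b → ∃ λ i → Within i a b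
  Reach⇒Within here = zero , refl
  Reach⇒Within (step r b∈X adj) with Reach⇒Within r
  ... | i , w = suc i , inj₂ (_ , w , b∈X , adj)

  reach? : ∀ a b → Dec (Reach X k a b)
  reach? a b = map′ (Within⇒Reach ∘ proj₂) Reach⇒Within (reachable? a b)

  ReachingFace : Subset n → Subset n → Set
  ReachingFace H R = FaceOfSize X (suc k) R × Reach X k R H

  reachingFace? : ∀ H → Decidable (ReachingFace H)
  reachingFace? H R = faceOfSize? X (suc k) R ×-dec reach? R H

  root : Subset n → Subset n
  root H = firstSubset (reachingFace? H)

  root-reaches : ∀ {H} → FaceOfSize X (suc k) H → ReachingFace H (root H)
  root-reaches {H} H∈X = firstSubset-satisfies (reachingFace? H) (H , H∈X , here)

  root-adjacent : ∀ {H H'} → FaceOfSize X (suc k) H → FaceOfSize X (suc k) H' → Adjacent k H H' →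
                  root H ≡ root H'
  root-adjacent {H} {H'} H∈X H'∈X adj = firstSubset-cong (reachingFace? H) (reachingFace? H')
    (λ (R∈X , r) → R∈X , step r H'∈X adj)
    (λ (R∈X , r) → R∈X , step r H∈X (Adjacent-sym adj))

  -- The junk value S only arises when S lies in no k-face, so by purity not for faces of X.
  faceRoot : Subset n → Subset n
  faceRoot S with anySubset? (λ H → faceOfSize? X (suc k) H ×-dec S ⊆? H)
  ... | yes (H , _) = root H
  ... | no _        = S

  faceRoot-facet : ∀ {H F} → FaceOfSize X (suc k) H → F ⊆ H → ∣ F ∣ ≡ k → faceRoot F ≡ root H
  faceRoot-facet {H} {F} H∈X F⊆H ∣F∣≡k with anySubset? (λ H → faceOfSize? X (suc k) H ×-dec F ⊆? H)
  ... | yes (H' , H'∈X , F⊆H') = root-adjacent H'∈X H∈X (F , ∣F∣≡k , F⊆H' , F⊆H)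
  ... | no ∄H                   = ⊥-elim (∄H (H , H∈X , F⊆H))

  faceRoot-kFace : ∀ {H} → FaceOfSize X (suc k) H → faceRoot H ≡ root H
  faceRoot-kFace {H} H∈X with anySubset? (λ H' → faceOfSize? X (suc k) H' ×-dec H ⊆? H')
  ... | yes (H' , H'∈X , H⊆H') =
    cong root (sym (⊆∧∣q∣≤∣p∣⇒≡ H⊆H' (≤-reflexive (trans (proj₂ H'∈X) (sym (proj₂ H∈X))))))
  ... | no ∄H                   = ⊥-elim (∄H (H , H∈X , ⊆-refl))

module Construction {n} (k : ℕ) (X : Complex n) (pure : Pure k X) (m : ℕ)
  (colourable : (H₀ : Subset n) → FaceOfSize X (suc k) H₀ → ChromaticAtMost X k H₀ m) where

  open Components k X

  compVertex? : ∀ R v → Dec (CompVertex X k R v)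
  compVertex? R v = anySubset? λ H → faceOfSize? X (suc k) H ×-dec reach? R H ×-dec v ∈? H

  -- 0 is a junk value: colour R is only used on the vertices of the component of a k-face R.
  colour : Subset n → Fin n → ℕ
  colour R v with faceOfSize? X (suc k) R
  ... | no _ = 0
  ... | yes R∈X with colourable R R∈X | compVertex? R v
  ...   | _ , _ , col , _ | yes v∈C = toℕ (col v v∈C)
  ...   | _               | no _    = 0

  colour-injects : ∀ {R H} → ReachingFace H R → FaceOfSize X (suc k) H → InjectsInto (colour R) H m
  colour-injects {R} {H} (R∈X , R↝H) H∈X = record { bounded = bounded ; injective = injective }
    where
    bounded : ∀ {v} → v ∈ H → colour R v < m
    bounded {v} v∈H with faceOfSize? X (suc k) R
    ... | no R∉X = contradiction R∈X R∉X
    ... | yes R∈X with colourable R R∈X | compVertex? R v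
    ...   | _ , c≤m , col , _ | yes v∈C = ≤-trans (Finₚ.toℕ<n (col v v∈C)) c≤m
    ...   | _                 | no v∉C  = contradiction (H , H∈X , R↝H , v∈H) v∉C
    injective : ∀ {u v} → u ∈ H → v ∈ H → colour R u ≡ colour R v → u ≡ v
    injective {u} {v} u∈H v∈H same with faceOfSize? X (suc k) R
    ... | no R∉X = contradiction R∈X R∉X
    ... | yes R∈X with colourable R R∈X | compVertex? R u | compVertex? R v
    ...   | _ , _ , col , proper | yes u∈C | yes v∈C with u Finₚ.≟ v
    ...     | yes u≡v = u≡v
    ...     | no u≢v  =
      contradiction (Finₚ.toℕ-injective same) (proper u v u∈C v∈C (u≢v , H , H∈X , R↝H , u∈H , v∈H))
    injective u∈H v∈H _ | yes _ | _ | no u∉C | _ = contradiction (H , H∈X , R↝H , u∈H) u∉C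
    injective u∈H v∈H _ | yes _ | _ | _ | no v∉C = contradiction (H , H∈X , R↝H , v∈H) v∉C

  labelling : Subset n → Fin n → ℕ
  labelling S = colour (faceRoot S)

  f : Subset n → Subset m
  f S = Image.image (labelling S) m S

  orientation : Orientation n
  orientation = (λ S → Inversions.sortSign (labelling S) S) , λ S → Inversions.sortSign-≤1 (labelling S) S

  positive : Orientation m
  positive = (λ _ → Sign.+) , λ _ _ → refl

  module AtKFace {H : Subset n} (H∈X : FaceOfSize X (suc k) H) where

    κ : Fin n → ℕ
    κ = colour (root H)

    open Image κ m
    open Inversions κ

    injects : InjectsInto κ H m
    injects = colour-injects (root-reaches H∈X) H∈X

    kFace-labelling : labelling H ≡ κ
    kFace-labelling = cong colour (faceRoot-kFace H∈X)

    facet-labelling : ∀ {F} → F ⊆ H → ∣ F ∣ ≡ k → labelling F ≡ κ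
    facet-labelling F⊆H ∣F∣≡k = cong colour (faceRoot-facet H∈X F⊆H ∣F∣≡k)

    fH≡ : f H ≡ image H
    fH≡ = cong (λ κ′ → Image.image κ′ m H) kFace-labelling

    fF≡ : ∀ {F} → F ⊆ H → ∣ F ∣ ≡ k → f F ≡ image F
    fF≡ {F} F⊆H ∣F∣≡k = cong (λ κ′ → Image.image κ′ m F) (facet-labelling F⊆H ∣F∣≡k)

    fH∈K : FaceOfSize (K k m) (suc k) (f H)
    fH∈K = K-faceOfSize (f H) ≤-refl (trans (cong ∣_∣ fH≡) (trans (∣image∣ H injects) (proj₂ H∈X)))

    fF∈K : ∀ {F} → F ⊆ H → ∣ F ∣ ≡ k → FaceOfSize (K k m) k (f F)
    fF∈K {F} F⊆H ∣F∣≡k = K-faceOfSize (f F) (n≤1+n k)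
      (trans (cong ∣_∣ (fF≡ F⊆H ∣F∣≡k)) (trans (∣image∣ F (InjectsInto-⊆ F⊆H injects)) ∣F∣≡k))

    deletion-facet : ∀ {x} → x ∈ H → FaceOfSize X k (H - x)
    deletion-facet {x} x∈H =
      down X H (H - x) (p─q⊆p _ _) (proj₁ H∈X) , x∈p⇒∣p-x∣≡pred x∈H (proj₂ H∈X)

    facet⇒deletion : ∀ {F} → FaceOfSize X k F → F ⊆ H → ∃ λ x → x ∈ H × F ≡ H - x
    facet⇒deletion (_ , ∣F∣≡k) F⊆H = ⊆∧suc∣p∣≡∣q∣⇒≡q-x F⊆H (trans (cong suc ∣F∣≡k) (sym (proj₂ H∈X)))

    facet-image : ∀ {F} → FaceOfSize X k F → F ⊆ H → FaceOfSize (K k m) k (f F) × f F ⊆ f H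
    facet-image (_ , ∣F∣≡k) F⊆H = fF∈K F⊆H ∣F∣≡k , λ i∈fF →
      subst (_ ∈_) (sym fH≡) (image-mono F⊆H (subst (_ ∈_) (fF≡ F⊆H ∣F∣≡k) i∈fF))

    deletion-preimage : ∀ {j} → HitFrom H j → ∃[ F ] (FaceOfSize X k F × F ⊆ H × f F ≡ image H - j)
    deletion-preimage {j} (x , x∈H , κx≡j) = H - x , deletion-facet x∈H , p─q⊆p _ _ , (begin
      f (H - x)      ≡⟨ fF≡ (p─q⊆p _ _) (proj₂ (deletion-facet x∈H)) ⟩
      image (H - x)  ≡⟨ image-remove injects x∈H κx≡j ⟩
      image H - j    ∎)
      where open ≡-Reasoning

    facet-preimage : ∀ {F'} → FaceOfSize (K k m) k F' → F' ⊆ f H →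
                     ∃[ F ] (FaceOfSize X k F × F ⊆ H × f F ≡ F')
    facet-preimage {F'} (_ , ∣F'∣≡k) F'⊆fH =
      let j , j∈imageH , F'≡ = ⊆∧suc∣p∣≡∣q∣⇒≡q-x F'⊆imageH ∣imageH∣≡
          F , F∈X , F⊆H , fF≡ = deletion-preimage (∈-image⁻ j∈imageH)
      in F , F∈X , F⊆H , trans fF≡ (sym F'≡)
      where
      F'⊆imageH : F' ⊆ image H
      F'⊆imageH = subst (F' ⊆_) fH≡ F'⊆fH
      ∣imageH∣≡ : suc ∣ F' ∣ ≡ ∣ image H ∣
      ∣imageH∣≡ = trans (cong suc ∣F'∣≡k) (sym (trans (cong ∣_∣ (sym fH≡)) (proj₂ fH∈K)))

    facets-correspond : ∀ F' → (∃[ F ] (FaceOfSize X k F × F ⊆ H × f F ≡ F'))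
                               ⇔ (FaceOfSize (K k m) k F' × F' ⊆ f H)
    facets-correspond F' = mk⇔
      (λ (F , F∈X , F⊆H , fF≡F') →
         subst (λ A → FaceOfSize (K k m) k A × A ⊆ f H) fF≡F' (facet-image F∈X F⊆H))
      (λ (F'∈K , F'⊆fH) → facet-preimage F'∈K F'⊆fH)

    deletion-incidence : ∀ {x} → x ∈ H →
                         incidence positive (f H) (f (H - x)) ≡ incidence orientation H (H - x)
    deletion-incidence {x} x∈H = begin
      signPow (removedPos (f H) (f (H - x)))
        ≡⟨ cong₂ (λ A B → signPow (removedPos A B)) fH≡ (fF≡ H-x⊆H ∣H-x∣≡k) ⟩
      signPow (removedPos (image H) (image (H - x)))
        ≡⟨ position-image injects x∈H ⟩
      sortSign H * (sortSign (H - x) * signPow (removedPos H (H - x)))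
        ≡⟨ sym (cong₂ (λ κ₁ κ₂ → Inversions.sortSign κ₁ H *
                                   (Inversions.sortSign κ₂ (H - x) * signPow (removedPos H (H - x))))
                      kFace-labelling (facet-labelling H-x⊆H ∣H-x∣≡k)) ⟩
      incidence orientation H (H - x)  ∎
      where
      open ≡-Reasoning
      H-x⊆H : H - x ⊆ H
      H-x⊆H = p─q⊆p _ _
      ∣H-x∣≡k : ∣ H - x ∣ ≡ k
      ∣H-x∣≡k = proj₂ (deletion-facet x∈H)

    incidences-agree : ∀ F → FaceOfSize X k F → F ⊆ H →
                       incidence positive (f H) (f F) ≡ incidence orientation H F
    incidences-agree F F∈X F⊆H =
      let x , x∈H , F≡H-x = facet⇒deletion F∈X F⊆H
      in subst (λ F → incidence positive (f H) (f F) ≡ incidence orientation H F)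
               (sym F≡H-x) (deletion-incidence x∈H)

  facets-map : ∀ F → FaceOfSize X k F → FaceOfSize (K k m) k (f F)
  facets-map F (F∈X , ∣F∣≡k) =
    let H , H∈X , F⊆H , maximal = maximal-extension X F∈X
    in AtKFace.fF∈K (H∈X , pure H H∈X maximal) F⊆H ∣F∣≡k

  hom : Hom k X (K k m)
  hom = f , facets-map , orientation , positive , λ H H∈X →
    f H , AtKFace.fH∈K H∈X , AtKFace.facets-correspond H∈X , AtKFace.incidences-agree H∈X

proposition7p7 : (k : ℕ) → 1 ≤ k → {n : ℕ} (X : Complex n) → Pure k X →
    (m : ℕ) →
    ((H₀ : Subset n) → FaceOfSize X (suc k) H₀ → ChromaticAtMost X k H₀ m) →
    ChiKAtMost k X m
-- The construction does not need 1 ≤ k.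
proposition7p7 k _ X pure m colourable = m , ≤-refl , Construction.hom k X pure m colourable
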